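{- Let $\ell_1,\ell_2,\ell_3$ be positive integers. There exists a flow-up class $\mathcal{G}_1=(0,g_2,g_3)$ on the edge-labeled triangle $(C_3,L)$ whose leading element is $g_2=\operatorname{lcm}(\ell_1,\gcd(\ell_2,\ell_3))$, and this is the smallest possible leading element: every flow-up class $(0,g_2',g_3')$ on $(C_3,L)$ with $g_2'>0$ satisfies $g_2'\ge \operatorname{lcm}(\ell_1,\gcd(\ell_2,\ell_3))$.
   Context: The edge-labeled triangle $(C_3,L)$ has vertices $v_1,v_2,v_3$, edge $v_1v_2$ labeled $\ell_1$, edge $v_2v_3$ labeled $\ell_2$, edge $v_3v_1$ labeled $\ell_3$. A generalized spline on $(C_3,L)$ is a triple $(g_1,g_2,g_3)\in\mathbb{Z}^3$ with $g_1\equiv g_2\pmod{\ell_1}$, $g_2\equiv g_3\pmod{\ell_2}$, $g_3\equiv g_1\pmod{\ell_3}$. A flow-up class $\mathcal{G}_1$ is a generalized spline of the form $(0,g_2,g_3)$ with $g_2\neq 0$. -}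

module Defs where

open import Data.Nat using (ℕ)
open import Data.Integer using (ℤ; +_; _-_; 0ℤ)
open import Data.Integer.Divisibility using (_∣_)
open import Data.Product using (_×_)
open import Relation.Binary.PropositionalEquality using (_≡_; _≢_)

_≡_[mod_] : ℤ → ℤ → ℕ → Set
a ≡ b [mod ℓ ] = (+ ℓ) ∣ (a - b)

IsSpline : (ℓ₁ ℓ₂ ℓ₃ : ℕ) → ℤ → ℤ → ℤ → Set
IsSpline ℓ₁ ℓ₂ ℓ₃ g₁ g₂ g₃ =
  (g₁ ≡ g₂ [mod ℓ₁ ]) × (g₂ ≡ g₃ [mod ℓ₂ ]) × (g₃ ≡ g₁ [mod ℓ₃ ])

IsFlowUp₁ : (ℓ₁ ℓ₂ ℓ₃ : ℕ) → ℤ → ℤ → Set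
IsFlowUp₁ ℓ₁ ℓ₂ ℓ₃ g₂ g₃ = IsSpline ℓ₁ ℓ₂ ℓ₃ 0ℤ g₂ g₃ × (g₂ ≢ 0ℤ)

-- A triple (0, g₂, g₃) is a spline iff ℓ₁ ∣ g₂, ℓ₂ ∣ g₂ - g₃ and ℓ₃ ∣ g₃. Such a g₃
-- exists iff g₂ ∈ ℓ₂ℤ + ℓ₃ℤ = gcd(ℓ₂, ℓ₃)ℤ (Bézout), so the leading elements of
-- flow-up classes are exactly the nonzero multiples of lcm(ℓ₁, gcd(ℓ₂, ℓ₃)).
module Submission where

open import Defs
open import Data.Nat using (ℕ; NonZero)
open import Data.Nat.GCD using (gcd)
open import Data.Nat.LCM using (lcm)
open import Data.Integer using (ℤ; +_; _≤_; _>_; 0ℤ)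
open import Data.Product using (_×_; ∃)
open import Relation.Binary.PropositionalEquality using (_≡_)

import Data.Nat as ℕ
import Data.Nat.Properties as ℕ
import Data.Nat.Divisibility as ℕ
open import Data.Nat.GCD using (gcd[m,n]∣m; gcd[m,n]∣n; gcd[m,n]≢0; gcd-GCD; module Bézout)
open import Data.Nat.LCM using (m∣lcm[m,n]; n∣lcm[m,n]; lcm-least; gcd*lcm)
open import Data.Integer using (-_; _+_; _-_; _*_; +≤+; +<+)
open import Data.Integer.Properties
  using (pos-+; pos-*; +-injective; +-identityˡ; +-identityʳ; neg-involutive)
open import Data.Integer.Divisibility.Signed
  using (_∣_; divides; ∣ᵤ⇒∣; ∣⇒∣ᵤ; ∣-refl; ∣-trans; ∣m⇒∣-m; ∣n⇒∣m*n; ∣m∣n⇒∣m+n)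
open import Data.Integer.Tactic.RingSolver using (solve-∀)
open import Data.Product using (_,_; map₂)
open import Data.Sum using (inj₁)
open import Function using (_∘_)
open import Relation.Binary.PropositionalEquality
  using (_≢_; sym; cong; subst; module ≡-Reasoning)

-- a and b are explicit: the congruence unfolds to ℓ ∣ ∣ a - b ∣, from which they
-- cannot be inferred.
[mod]⇒∣ : ∀ {ℓ} a b → a ≡ b [mod ℓ ] → + ℓ ∣ a - b
[mod]⇒∣ _ _ = ∣ᵤ⇒∣

∣⇒[mod] : ∀ {ℓ} a b → + ℓ ∣ a - b → a ≡ b [mod ℓ ]
∣⇒[mod] _ _ = ∣⇒∣ᵤ

0≡[mod]⇒∣ : ∀ {ℓ} a → 0ℤ ≡ a [mod ℓ ] → + ℓ ∣ a
0≡[mod]⇒∣ {ℓ} a 0≡a = subst (+ ℓ ∣_) (neg-involutive a)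
  (∣m⇒∣-m (subst (+ ℓ ∣_) (+-identityˡ (- a)) ([mod]⇒∣ 0ℤ a 0≡a)))

∣⇒0≡[mod] : ∀ {ℓ} a → + ℓ ∣ a → 0ℤ ≡ a [mod ℓ ]
∣⇒0≡[mod] {ℓ} a ℓ∣a = ∣⇒[mod] 0ℤ a (subst (+ ℓ ∣_) (sym (+-identityˡ (- a))) (∣m⇒∣-m ℓ∣a))

≡0[mod]⇒∣ : ∀ {ℓ} a → a ≡ 0ℤ [mod ℓ ] → + ℓ ∣ a
≡0[mod]⇒∣ {ℓ} a a≡0 = subst (+ ℓ ∣_) (+-identityʳ a) ([mod]⇒∣ a 0ℤ a≡0)

∣⇒≡0[mod] : ∀ {ℓ} a → + ℓ ∣ a → a ≡ 0ℤ [mod ℓ ]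
∣⇒≡0[mod] {ℓ} a ℓ∣a = ∣⇒[mod] a 0ℤ (subst (+ ℓ ∣_) (sym (+-identityʳ a)) ℓ∣a)

pos-∣ : ∀ {m n} → m ℕ.∣ n → + m ∣ + n
pos-∣ = ∣ᵤ⇒∣

gcd≢0 : ∀ m n .{{_ : NonZero m}} → NonZero (gcd m n)
gcd≢0 m n = ℕ.≢-nonZero (gcd[m,n]≢0 m n (inj₁ (ℕ.≢-nonZero⁻¹ m)))

lcm≢0 : ∀ m n .{{m≢0 : NonZero m}} .{{n≢0 : NonZero n}} → lcm m n ≢ 0
lcm≢0 m n lcm≡0 = ℕ.≢-nonZero⁻¹ (m ℕ.* n) {{ℕ.m*n≢0 m n}} (begin
  m ℕ.* n             ≡⟨ gcd*lcm m n ⟨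
  gcd m n ℕ.* lcm m n ≡⟨ cong (gcd m n ℕ.*_) lcm≡0 ⟩
  gcd m n ℕ.* 0       ≡⟨ ℕ.*-zeroʳ (gcd m n) ⟩
  0                   ∎)
  where open ≡-Reasoning

∣⇒≤ : ∀ {m i} → + m ∣ i → i > 0ℤ → + m ≤ i
∣⇒≤ {i = + ℕ.suc n} m∣i _ = +≤+ (ℕ.∣⇒≤ (∣⇒∣ᵤ m∣i))
∣⇒≤ {i = + ℕ.zero}  _   (+<+ ())

-- From d + y n = x m, the multiple c = q d splits as q x m + (- q y n).
split-by-identity : ∀ {d m n c} x y → d ℕ.+ y ℕ.* n ≡ x ℕ.* m → + d ∣ c →
                    ∃ λ g → + m ∣ c - g × + n ∣ g
split-by-identity {d} {m} {n} {c} x y d+yn≡xm (divides q c≡qd) =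
  - (q * Y) , subst (+ m ∣_) (sym c-g≡qxm) (∣n⇒∣m*n q (∣n⇒∣m*n (+ x) ∣-refl))
            , ∣m⇒∣-m (∣n⇒∣m*n q (∣n⇒∣m*n (+ y) ∣-refl))
  where
  open ≡-Reasoning
  Y = + y * + n
  d+Y≡xm : + d + Y ≡ + x * + m
  d+Y≡xm = begin
    + d + + y * + n   ≡⟨ cong (_+_ (+ d)) (pos-* y n) ⟨
    + d + + (y ℕ.* n) ≡⟨ pos-+ d (y ℕ.* n) ⟨
    + (d ℕ.+ y ℕ.* n) ≡⟨ cong +_ d+yn≡xm ⟩
    + (x ℕ.* m)       ≡⟨ pos-* x m ⟩
    + x * + m         ∎
  distrib : ∀ q D Y → q * D - - (q * Y) ≡ q * (D + Y)
  distrib = solve-∀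
  c-g≡qxm : c - - (q * Y) ≡ q * (+ x * + m)
  c-g≡qxm = begin
    c - - (q * Y)       ≡⟨ cong (λ c → c - - (q * Y)) c≡qd ⟩
    q * + d - - (q * Y) ≡⟨ distrib q (+ d) Y ⟩
    q * (+ d + Y)       ≡⟨ cong (q *_) d+Y≡xm ⟩
    q * (+ x * + m)     ∎

split-swap : ∀ {m n c} → (∃ λ g → + n ∣ c - g × + m ∣ g) → ∃ λ g → + m ∣ c - g × + n ∣ g
split-swap {m} {c = c} (g , n∣c-g , m∣g) = c - g , subst (+ m ∣_) (sym (c-[c-g]≡g c g)) m∣g , n∣c-g
  where
  c-[c-g]≡g : ∀ c g → c - (c - g) ≡ g
  c-[c-g]≡g = solve-∀

gcd∣⇒split : ∀ m n {c} → + gcd m n ∣ c → ∃ λ g → + m ∣ c - g × + n ∣ g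
gcd∣⇒split m n {c} with Bézout.identity (gcd-GCD m n)
... | Bézout.+- x y d+yn≡xm = split-by-identity x y d+yn≡xm
... | Bézout.-+ x y d+xm≡yn = split-swap {c = c} ∘ split-by-identity y x d+xm≡yn

spline₀⇒lcm∣ : ∀ ℓ₁ ℓ₂ ℓ₃ {g₂ g₃} → IsSpline ℓ₁ ℓ₂ ℓ₃ 0ℤ g₂ g₃ → + lcm ℓ₁ (gcd ℓ₂ ℓ₃) ∣ g₂
spline₀⇒lcm∣ ℓ₁ ℓ₂ ℓ₃ {g₂} {g₃} (0≡g₂ , g₂≡g₃ , g₃≡0) =
  ∣ᵤ⇒∣ (lcm-least (∣⇒∣ᵤ (0≡[mod]⇒∣ g₂ 0≡g₂)) (∣⇒∣ᵤ gcd∣g₂))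
  where
  [a-b]+b≡a : ∀ a b → (a - b) + b ≡ a
  [a-b]+b≡a = solve-∀
  gcd∣g₂ : + gcd ℓ₂ ℓ₃ ∣ g₂
  gcd∣g₂ = subst (+ gcd ℓ₂ ℓ₃ ∣_) ([a-b]+b≡a g₂ g₃)
    (∣m∣n⇒∣m+n (∣-trans (pos-∣ (gcd[m,n]∣m ℓ₂ ℓ₃)) ([mod]⇒∣ g₂ g₃ g₂≡g₃))
               (∣-trans (pos-∣ (gcd[m,n]∣n ℓ₂ ℓ₃)) (≡0[mod]⇒∣ g₃ g₃≡0)))

lcm∣⇒spline₀ : ∀ ℓ₁ ℓ₂ ℓ₃ {g₂} → + lcm ℓ₁ (gcd ℓ₂ ℓ₃) ∣ g₂ → ∃ λ g₃ → IsSpline ℓ₁ ℓ₂ ℓ₃ 0ℤ g₂ g₃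
lcm∣⇒spline₀ ℓ₁ ℓ₂ ℓ₃ {g₂} lcm∣g₂
  with gcd∣⇒split ℓ₂ ℓ₃ (∣-trans (pos-∣ (n∣lcm[m,n] ℓ₁ (gcd ℓ₂ ℓ₃))) lcm∣g₂)
... | g₃ , ℓ₂∣g₂-g₃ , ℓ₃∣g₃ =
  g₃ , ∣⇒0≡[mod] g₂ (∣-trans (pos-∣ (m∣lcm[m,n] ℓ₁ (gcd ℓ₂ ℓ₃))) lcm∣g₂)
     , ∣⇒[mod] g₂ g₃ ℓ₂∣g₂-g₃
     , ∣⇒≡0[mod] g₃ ℓ₃∣g₃

theorem3p2 : (ℓ₁ ℓ₂ ℓ₃ : ℕ) → .{{NonZero ℓ₁}} → .{{NonZero ℓ₂}} → .{{NonZero ℓ₃}} →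
    (∃ λ (g₃ : ℤ) → IsFlowUp₁ ℓ₁ ℓ₂ ℓ₃ (+ lcm ℓ₁ (gcd ℓ₂ ℓ₃)) g₃)
    × (∀ (g₂′ g₃′ : ℤ) → IsFlowUp₁ ℓ₁ ℓ₂ ℓ₃ g₂′ g₃′ → g₂′ > 0ℤ →
         + lcm ℓ₁ (gcd ℓ₂ ℓ₃) ≤ g₂′)
theorem3p2 ℓ₁ ℓ₂ ℓ₃ = map₂ (_, L≢0 ∘ +-injective) spline , minimality
  where
  spline : ∃ λ g₃ → IsSpline ℓ₁ ℓ₂ ℓ₃ 0ℤ (+ lcm ℓ₁ (gcd ℓ₂ ℓ₃)) g₃
  spline = lcm∣⇒spline₀ ℓ₁ ℓ₂ ℓ₃ ∣-refl
  L≢0 : lcm ℓ₁ (gcd ℓ₂ ℓ₃) ≢ 0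
  L≢0 = lcm≢0 ℓ₁ (gcd ℓ₂ ℓ₃) {{n≢0 = gcd≢0 ℓ₂ ℓ₃}}
  minimality : ∀ (g₂′ g₃′ : ℤ) → IsFlowUp₁ ℓ₁ ℓ₂ ℓ₃ g₂′ g₃′ → g₂′ > 0ℤ →
               + lcm ℓ₁ (gcd ℓ₂ ℓ₃) ≤ g₂′
  minimality _ _ (spline₀ , _) = ∣⇒≤ (spline₀⇒lcm∣ ℓ₁ ℓ₂ ℓ₃ spline₀)
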